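{- Let $G$ be a connected graph with at least two vertices and let $\sigma$ be a search ordering of $G$ produced by a layered graph search, starting at a vertex $r$. Then the number of leaves of the $\mathcal{F}$-tree of $\sigma$ is at least the maximum, over all $i \ge 0$, of the number of vertices of $G$ at distance exactly $i$ from $r$.
   Context: All graphs are finite, simple, undirected, connected and non-empty. A graph search traverses all vertices of a connected graph; its search ordering $\sigma=(v_1,\dots,v_n)$ lists vertices in the order visited, and every prefix induces a connected subgraph. A graph search is layered if it visits the distance layers of its start vertex in increasing order (all vertices at distance $i$ from the start vertex before any at distance $i+1$). The $\mathcal{F}$-tree (first-in tree) of $\sigma=(v_1,\dots,v_n)$ is the spanning tree rooted at $v_1$ in which, for each $1<i\le n$, the parent of $v_i$ is its neighbor that appears leftmost in $\sigma$. A vertex of a rooted tree is a leaf if it has no children; by convention the root is never counted as a leaf (even if it has degree one). All other vertices are internal. -}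

module Defs where

open import Data.Nat using (ℕ; zero; suc; _<_; _≤ᵇ_)
open import Data.Fin using (Fin; toℕ; _≟_)
open import Data.Fin.Permutation using (Permutation′; _⟨$⟩ʳ_; _⟨$⟩ˡ_)
open import Data.Bool using (Bool; true; false; _∧_; _∨_; not; if_then_else_)
open import Data.List using (List; []; _∷_; length; filterᵇ)
open import Data.Bool.ListAction using (any; all)
open import Data.List using (allFin) public
open import Relation.Nullary.Decidable using (⌊_⌋)
open import Relation.Binary.PropositionalEquality using (_≡_)

record Graph (n : ℕ) : Set where
  field
    adj    : Fin n → Fin n → Bool
    sym    : ∀ u v → adj u v ≡ adj v u
    irrefl : ∀ v → adj v v ≡ false
open Graph public

module _ {n : ℕ} (G : Graph n) where

  data WalkIn (S : Fin n → Bool) : Fin n → Fin n → Set where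
    here : ∀ {v} → S v ≡ true → WalkIn S v v
    step : ∀ {u w v} → S u ≡ true → adj G u w ≡ true → WalkIn S w v → WalkIn S u v

  InducedConnected : (Fin n → Bool) → Set
  InducedConnected S = ∀ u v → S u ≡ true → S v ≡ true → WalkIn S u v

  Connected : Set
  Connected = InducedConnected (λ _ → true)

  -- ball r k v = true iff dist(r, v) ≤ k
  ball : Fin n → ℕ → Fin n → Bool
  ball r zero v = ⌊ r ≟ v ⌋
  ball r (suc k) v = ball r k v ∨ any (λ u → ball r k u ∧ adj G u v) (allFin n)

  layer : Fin n → ℕ → Fin n → Bool
  layer r zero v = ball r zero v
  layer r (suc i) v = ball r (suc i) v ∧ not (ball r i v)

count : {n : ℕ} → (Fin n → Bool) → ℕ
count {n} p = length (filterᵇ p (allFin n))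

-- σ : Permutation′ n ; σ ⟨$⟩ʳ j is the vertex v_{j+1} at position j, σ ⟨$⟩ˡ v its position.
module _ {n : ℕ} (G : Graph n) (σ : Permutation′ n) where

  pos : Fin n → ℕ
  pos v = toℕ (σ ⟨$⟩ˡ v)

  IsSearchOrdering : Set
  IsSearchOrdering = ∀ (k : Fin n) → InducedConnected G (λ v → pos v ≤ᵇ toℕ k)

  IsLayered : Fin n → Set
  IsLayered r = ∀ (j k : Fin n) (i i′ : ℕ) →
    layer G r i (σ ⟨$⟩ʳ j) ≡ true → layer G r i′ (σ ⟨$⟩ʳ k) ≡ true → i < i′ → toℕ j < toℕ k

  -- in the F-tree of σ (rooted at r = v_1): u is the parent of w (w ≠ r)
  -- iff u is the neighbour of w appearing leftmost in σ
  isParent : Fin n → Fin n → Fin n → Bool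
  isParent r u w = not ⌊ w ≟ r ⌋ ∧ adj G u w ∧
    all (λ u′ → if adj G u′ w then pos u ≤ᵇ pos u′ else true) (allFin n)

  isLeaf : Fin n → Fin n → Bool
  isLeaf r v = not ⌊ v ≟ r ⌋ ∧ not (any (λ w → isParent r v w) (allFin n))

  numLeaves : Fin n → ℕ
  numLeaves r = count (isLeaf r)

-- In a layered search, a vertex w ≠ r at distance i + 1 has a neighbour at distance i,
-- and that neighbour precedes in σ every neighbour of w at a larger distance; so the
-- leftmost neighbour of w, its F-parent, lies at distance exactly i. Sending each
-- internal vertex of layer i to one of its children is therefore an injection into
-- layer i + 1 (children have a unique parent), whence
--   |L i| ≤ (leaves in L i) + |L (i + 1)|.
-- Unfolding this until the layers become empty bounds |L i| by the number of leaves at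
-- distance ≥ i. The root is internal because G has a second vertex.
module Submission where

open import Data.Bool using (Bool; true; false; _∧_; _∨_; not; if_then_else_; T)
open import Data.Bool.Properties using (∧-conicalˡ; ∧-conicalʳ; ∨-zeroʳ; not-injective; not-¬; T-≡)
open import Data.Bool.ListAction using (any; all)
open import Data.Empty using (⊥)
open import Data.Fin using (Fin; zero; suc; toℕ; _≟_)
open import Data.Fin.Properties using (toℕ-injective; toℕ<n)
open import Data.Fin.Permutation using (Permutation′; _⟨$⟩ʳ_; _⟨$⟩ˡ_; inverseˡ; inverseʳ)
open import Data.List using (List; []; _∷_; length; filter; filterᵇ)
open import Data.List.Properties using (filter-notAll)
open import Data.List.Membership.Propositional using (_∈_)
open import Data.List.Membership.Propositional.Properties using (∈-filter⁺; ∈-filter⁻; ∈-allFin)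
open import Data.List.Relation.Unary.Any as Any using (here; there)
open import Data.List.Relation.Unary.Any.Properties using (any⁺; any⁻)
open import Data.List.Relation.Unary.All as All using ()
open import Data.List.Relation.Unary.All.Properties using (all⁺; all⁻)
open import Data.List.Relation.Unary.AllPairs using (_∷_)
open import Data.List.Relation.Unary.Unique.Propositional using (Unique)
open import Data.List.Relation.Unary.Unique.Propositional.Properties using (filter⁺; allFin⁺)
open import Data.Nat using (ℕ; zero; suc; _+_; _≤_; _<_; z≤n; s≤s; _≤ᵇ_)
open import Data.Nat.Properties
  using (≤-refl; ≤-trans; ≤-antisym; <-irrefl; <-≤-trans; ≤-<-trans; m≤n⇒m≤1+n; m≤n⇒m<n∨m≡n;
         m≤m+n; +-suc; ≤-pred; <⇒≱; module ≤-Reasoning; +-monoʳ-≤; ≤ᵇ⇒≤)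
open import Data.Product using (∃; _×_; _,_; proj₂)
import Data.Product as Product
open import Data.Sum using (inj₁; inj₂)
open import Function using (_∘_; Equivalence)
open import Relation.Binary.Definitions using (DecidableEquality)
open import Relation.Binary.PropositionalEquality using (_≡_; _≢_; refl; sym; trans; cong; subst)
open import Relation.Nullary using (yes; no; contradiction)
open import Relation.Nullary.Decidable using (⌊_⌋; ¬?; T?; toWitness; toWitnessFalse; fromWitnessFalse)
open import Defs hiding (sym)

T⇒≡true : ∀ {b} → T b → b ≡ true
T⇒≡true = Equivalence.to T-≡

≡true⇒T : ∀ {b} → b ≡ true → T b
≡true⇒T = Equivalence.from T-≡

∧-intro : ∀ {a b} → a ≡ true → b ≡ true → a ∧ b ≡ true
∧-intro refl refl = refl

if-then-intro : ∀ b {c} → (b ≡ true → c ≡ true) → (if b then c else true) ≡ true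
if-then-intro true  c-holds = c-holds refl
if-then-intro false _       = refl

if-then-elim : ∀ {b c} → b ≡ true → (if b then c else true) ≡ true → c ≡ true
if-then-elim refl c-holds = c-holds

module _ {A : Set} {p : A → Bool} where

  any-≡true⁺ : ∀ {x xs} → x ∈ xs → p x ≡ true → any p xs ≡ true
  any-≡true⁺ x∈xs px = T⇒≡true (any⁺ p (Any.map (λ { refl → ≡true⇒T px }) x∈xs))

  any-≡true⁻ : ∀ xs → any p xs ≡ true → ∃ λ x → p x ≡ true
  any-≡true⁻ xs e = Product.map₂ T⇒≡true (Any.satisfied (any⁻ p xs (≡true⇒T e)))

  all-≡true⁺ : ∀ xs → (∀ x → p x ≡ true) → all p xs ≡ true
  all-≡true⁺ xs p-holds = T⇒≡true (all⁻ p (All.universal (≡true⇒T ∘ p-holds) xs))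

  all-≡true⁻ : ∀ {x xs} → x ∈ xs → all p xs ≡ true → p x ≡ true
  all-≡true⁻ {xs = xs} x∈xs e = T⇒≡true (All.lookup (all⁺ p xs (≡true⇒T e)) x∈xs)

  findOr : A → List A → A
  findOr d []       = d
  findOr d (x ∷ xs) = if p x then x else findOr d xs

  findOr-satisfies : ∀ d xs → any p xs ≡ true → p (findOr d xs) ≡ true
  findOr-satisfies d (x ∷ xs) e with p x in px
  ... | true  = px
  ... | false = findOr-satisfies d xs e

module _ {A : Set} where

  countIn : (A → Bool) → List A → ℕ
  countIn p xs = length (filterᵇ p xs)

  countIn-mono : ∀ (p q : A → Bool) → (∀ x → p x ≡ true → q x ≡ true) →
                 ∀ xs → countIn p xs ≤ countIn q xs
  countIn-mono p q p⇒q []       = z≤n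
  countIn-mono p q p⇒q (x ∷ xs) with p x in px | q x in qx
  ... | true  | true  = s≤s (countIn-mono p q p⇒q xs)
  ... | true  | false with () ← trans (sym (p⇒q x px)) qx
  ... | false | true  = m≤n⇒m≤1+n (countIn-mono p q p⇒q xs)
  ... | false | false = countIn-mono p q p⇒q xs

  countIn-split : ∀ (p q : A → Bool) xs →
                  countIn p xs ≡ countIn (λ x → p x ∧ q x) xs + countIn (λ x → p x ∧ not (q x)) xs
  countIn-split p q []       = refl
  countIn-split p q (x ∷ xs) with p x | q x
  ... | true  | true  = cong suc (countIn-split p q xs)
  ... | true  | false = trans (cong suc (countIn-split p q xs)) (sym (+-suc _ _))
  ... | false | _     = countIn-split p q xs

  countIn-disjoint : ∀ (p q s : A → Bool) →
                     (∀ x → p x ≡ true → s x ≡ true) → (∀ x → q x ≡ true → s x ≡ true) →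
                     (∀ x → p x ≡ true → q x ≡ true → ⊥) →
                     ∀ xs → countIn p xs + countIn q xs ≤ countIn s xs
  countIn-disjoint p q s p⇒s q⇒s disj []       = z≤n
  countIn-disjoint p q s p⇒s q⇒s disj (x ∷ xs) with p x in px | q x in qx | s x in sx
  ... | true  | true  | _     with () ← disj x px qx
  ... | true  | false | false with () ← trans (sym (p⇒s x px)) sx
  ... | false | true  | false with () ← trans (sym (q⇒s x qx)) sx
  ... | true  | false | true  = s≤s (countIn-disjoint p q s p⇒s q⇒s disj xs)
  ... | false | true  | true  =
    subst (_≤ suc (countIn s xs)) (sym (+-suc _ _)) (s≤s (countIn-disjoint p q s p⇒s q⇒s disj xs))
  ... | false | false | true  = m≤n⇒m≤1+n (countIn-disjoint p q s p⇒s q⇒s disj xs)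
  ... | false | false | false = countIn-disjoint p q s p⇒s q⇒s disj xs

module _ {A B : Set} (_≟B_ : DecidableEquality B) where

  length≤-injectiveOn : (f : A → B) {xs : List A} {ys : List B} → Unique xs →
                        (∀ {x} → x ∈ xs → f x ∈ ys) →
                        (∀ {x y} → x ∈ xs → y ∈ xs → f x ≡ f y → x ≡ y) →
                        length xs ≤ length ys
  length≤-injectiveOn f {[]}     _            _    _     = z≤n
  length≤-injectiveOn f {x ∷ xs} {ys} (x∉xs ∷ xs!) f∈ys f-inj =
    ≤-<-trans (length≤-injectiveOn f xs! f∈ys′ (λ y∈ z∈ → f-inj (there y∈) (there z∈)))
              (filter-notAll (¬? ∘ (f x ≟B_)) ys (Any.map (λ fx≡y fx≢y → fx≢y fx≡y) fx∈ys))
    where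
    fx∈ys : f x ∈ ys
    fx∈ys = f∈ys (here refl)

    f∈ys′ : ∀ {z} → z ∈ xs → f z ∈ filter (¬? ∘ (f x ≟B_)) ys
    f∈ys′ z∈xs = ∈-filter⁺ (¬? ∘ (f x ≟B_)) (f∈ys (there z∈xs))
                           (All.lookup x∉xs z∈xs ∘ f-inj (here refl) (there z∈xs))

injectiveOn⇒count≤ : ∀ {m n} (p : Fin m → Bool) (q : Fin n → Bool) (f : Fin m → Fin n) →
                     (∀ v → p v ≡ true → q (f v) ≡ true) →
                     (∀ v w → p v ≡ true → p w ≡ true → f v ≡ f w → v ≡ w) →
                     count p ≤ count q
injectiveOn⇒count≤ {m} {n} p q f p⇒qf f-inj =
  length≤-injectiveOn _≟_ f (filter⁺ (T? ∘ p) (allFin⁺ m)) f∈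
    (λ v∈ w∈ → f-inj _ _ (selected p v∈) (selected p w∈))
  where
  selected : ∀ {k} (s : Fin k → Bool) {v} → v ∈ filterᵇ s (allFin k) → s v ≡ true
  selected {k} s v∈ = T⇒≡true (proj₂ (∈-filter⁻ (T? ∘ s) {xs = allFin k} v∈))

  f∈ : ∀ {v} → v ∈ filterᵇ p (allFin m) → f v ∈ filterᵇ q (allFin n)
  f∈ {v} v∈ = ∈-filter⁺ (T? ∘ q) (∈-allFin (f v)) (≡true⇒T (p⇒qf v (selected p v∈)))

module Layers {n : ℕ} (G : Graph n) (r : Fin n) where

  ball-suc : ∀ {j v} → ball G r j v ≡ true → ball G r (suc j) v ≡ true
  ball-suc b rewrite b = refl

  ball-mono : ∀ {i j v} → i ≤ j → ball G r i v ≡ true → ball G r j v ≡ true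
  ball-mono {j = zero}  z≤n     b = b
  ball-mono {j = suc j} i≤1+j b with m≤n⇒m<n∨m≡n i≤1+j
  ... | inj₂ refl       = b
  ... | inj₁ (s≤s i≤j) = ball-suc {j} (ball-mono i≤j b)

  ball-step : ∀ {j u v} → ball G r j u ≡ true → adj G u v ≡ true → ball G r (suc j) v ≡ true
  ball-step {j} {u} {v} bu uv =
    trans (cong (ball G r j v ∨_) (any-≡true⁺ (∈-allFin u) (∧-intro bu uv))) (∨-zeroʳ _)

  layer⇒ball : ∀ {i v} → layer G r i v ≡ true → ball G r i v ≡ true
  layer⇒ball {zero}  l = l
  layer⇒ball {suc i} l = ∧-conicalˡ _ _ l

  layer-suc⇒∉ball : ∀ {i v} → layer G r (suc i) v ≡ true → ball G r i v ≡ false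
  layer-suc⇒∉ball l = not-injective (∧-conicalʳ _ _ l)

  adjacentToBall : ℕ → Fin n → Bool
  adjacentToBall j v = any (λ u → ball G r j u ∧ adj G u v) (allFin n)

  ball-suc⇒adjacentToBall : ∀ {j v} → ball G r (suc j) v ≡ true → ball G r j v ≡ false →
                            ∃ λ u → ball G r j u ≡ true × adj G u v ≡ true
  ball-suc⇒adjacentToBall {j} {v} b b′ =
    let u , bu∧uv = any-≡true⁻ (allFin n) (subst (λ c → c ∨ adjacentToBall j v ≡ true) b′ b) in
    u , ∧-conicalˡ _ _ bu∧uv , ∧-conicalʳ (ball G r j u) _ bu∧uv

  ball⇒layer : ∀ j {v} → ball G r j v ≡ true → ∃ λ i → i ≤ j × layer G r i v ≡ true
  ball⇒layer zero    b = zero , z≤n , b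
  ball⇒layer (suc j) {v} b with ball G r j v in bj
  ... | true  = let i , i≤j , l = ball⇒layer j bj in i , m≤n⇒m≤1+n i≤j , l
  ... | false = suc j , ≤-refl , ∧-intro (trans (cong (_∨ adjacentToBall j v) bj) b) (cong not bj)

  layer-zero⇒root : ∀ {v} → layer G r zero v ≡ true → v ≡ r
  layer-zero⇒root l = sym (toWitness (≡true⇒T l))

  -- A neighbour u in ball i lies in some layer j ≤ i, and j < i would put v in ball i.
  layer-suc⇒neighbour : ∀ {i v} → layer G r (suc i) v ≡ true →
                        ∃ λ u → layer G r i u ≡ true × adj G u v ≡ true
  layer-suc⇒neighbour {i} l
    with u , bu , uv ← ball-suc⇒adjacentToBall {i} (layer⇒ball {suc i} l) (layer-suc⇒∉ball {i} l)
    with j , j≤i , lu ← ball⇒layer i bu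
    with m≤n⇒m<n∨m≡n j≤i
  ... | inj₂ refl = u , lu , uv
  ... | inj₁ j<i  with () ← not-¬ (ball-mono j<i (ball-step {j} (layer⇒ball {j} lu) uv))
                                  (layer-suc⇒∉ball {i} l)

  distAtLeast : ℕ → Fin n → Bool
  distAtLeast zero    _ = true
  distAtLeast (suc i) v = not (ball G r i v)

  layer⇒distAtLeast : ∀ i {v} → layer G r i v ≡ true → distAtLeast i v ≡ true
  layer⇒distAtLeast zero    _ = refl
  layer⇒distAtLeast (suc i) l = cong not (layer-suc⇒∉ball {i} l)

  distAtLeast-suc : ∀ i {v} → distAtLeast (suc i) v ≡ true → distAtLeast i v ≡ true
  distAtLeast-suc zero    _ = refl
  distAtLeast-suc (suc i) {v} d with ball G r i v
  ... | false = refl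
  ... | true  with () ← d

module FTree {n : ℕ} (G : Graph n) (σ : Permutation′ n) (r : Fin n) where
  open Layers G r

  pos-injective : ∀ {u v} → pos G σ u ≡ pos G σ v → u ≡ v
  pos-injective e = trans (sym (inverseʳ σ)) (trans (cong (σ ⟨$⟩ʳ_) (toℕ-injective e)) (inverseʳ σ))

  parent-≢root : ∀ {u w} → isParent G σ r u w ≡ true → w ≢ r
  parent-≢root {w = w} p = toWitnessFalse (≡true⇒T (∧-conicalˡ (not ⌊ w ≟ r ⌋) _ p))

  parent-adj : ∀ {u w} → isParent G σ r u w ≡ true → adj G u w ≡ true
  parent-adj {u} {w} p = ∧-conicalˡ (adj G u w) _ (∧-conicalʳ (not ⌊ w ≟ r ⌋) _ p)

  parent-leftmost : ∀ {u w u′} → isParent G σ r u w ≡ true → adj G u′ w ≡ true →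
                    pos G σ u ≤ pos G σ u′
  parent-leftmost {u} {w} {u′} p u′w =
    ≤ᵇ⇒≤ _ _ (≡true⇒T (if-then-elim u′w (all-≡true⁻ (∈-allFin u′) leftmost)))
    where
    leftmost = ∧-conicalʳ (adj G u w) _ (∧-conicalʳ (not ⌊ w ≟ r ⌋) _ p)

  parent-unique : ∀ {u u′ w} → isParent G σ r u w ≡ true → isParent G σ r u′ w ≡ true →
                  u ≡ u′
  parent-unique {u} {u′} {w} p p′ =
    pos-injective (≤-antisym (parent-leftmost {u} {w} p (parent-adj {u′} {w} p′))
                             (parent-leftmost {u′} {w} p′ (parent-adj {u} {w} p)))

  module _ (layered : IsLayered G σ r) where

    layer<⇒pos< : ∀ {i i′ u w} → layer G r i u ≡ true → layer G r i′ w ≡ true → i < i′ →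
                  pos G σ u < pos G σ w
    layer<⇒pos< {i} {i′} lu lw =
      layered _ _ i i′ (subst (λ x → layer G r i x ≡ true) (sym (inverseʳ σ)) lu)
                       (subst (λ x → layer G r i′ x ≡ true) (sym (inverseʳ σ)) lw)

    layer⇒≤pos : ∀ i {v} → layer G r i v ≡ true → i ≤ pos G σ v
    layer⇒≤pos zero    _ = z≤n
    layer⇒≤pos (suc i) l =
      let u , lu , _ = layer-suc⇒neighbour {i} l in
      ≤-<-trans (layer⇒≤pos i lu) (layer<⇒pos< {i} {suc i} lu l ≤-refl)

    -- w, adjacent to v, lies in a layer ≤ i + 1: not layer 0 since w ≠ r, and not a layer
    -- j + 1 with j < i, since then its neighbour in layer j would precede its parent v.
    parent-layer : ∀ {i v w} → isParent G σ r v w ≡ true → layer G r i v ≡ true →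
                   layer G r (suc i) w ≡ true
    parent-layer {i} p lv with ball⇒layer (suc i) (ball-step {i} (layer⇒ball {i} lv) (parent-adj p))
    ... | zero  , _ , lw = contradiction (layer-zero⇒root lw) (parent-≢root p)
    ... | suc j , j<1+i , lw with m≤n⇒m<n∨m≡n (≤-pred j<1+i)
    ...   | inj₂ refl = lw
    ...   | inj₁ j<i  = let u , lu , uw = layer-suc⇒neighbour {j} lw in
                        contradiction (<-≤-trans (layer<⇒pos< lu lv j<i) (parent-leftmost p uw))
                                      (<-irrefl refl)

    layer-empty : ∀ i {v} → n ≤ i → layer G r i v ≢ true
    layer-empty i n≤i l = contradiction (≤-trans n≤i (layer⇒≤pos i l)) (<⇒≱ (toℕ<n _))

module LeafBound {k : ℕ} (G : Graph (suc k)) (σ : Permutation′ (suc k)) (connected : Connected G)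
                 (layered : IsLayered G σ (σ ⟨$⟩ʳ zero))
                 {w : Fin (suc k)} (w≢r : w ≢ σ ⟨$⟩ʳ zero) where

  r : Fin (suc k)
  r = σ ⟨$⟩ʳ zero

  open Layers G r
  open FTree G σ r

  pos-root : pos G σ r ≡ 0
  pos-root = cong toℕ (inverseˡ σ)

  root-hasNeighbour : ∃ λ x → adj G r x ≡ true
  root-hasNeighbour with connected r w refl refl
  ... | here _      = contradiction refl w≢r
  ... | step _ rx _ = _ , rx

  neighbour⇒child-of-root : ∀ {x} → adj G r x ≡ true → isParent G σ r r x ≡ true
  neighbour⇒child-of-root {x} rx =
    ∧-intro {not ⌊ x ≟ r ⌋} (T⇒≡true (fromWitnessFalse x≢r))
      (∧-intro rx (all-≡true⁺ (allFin (suc k)) λ u →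
        if-then-intro (adj G u x) λ _ → cong (_≤ᵇ pos G σ u) pos-root))
    where
    x≢r : x ≢ r
    x≢r refl = not-¬ rx (irrefl G r)

  internal⇒hasChild : ∀ v → isLeaf G σ r v ≡ false →
                      any (isParent G σ r v) (allFin (suc k)) ≡ true
  internal⇒hasChild v internal with v ≟ r
  ... | yes refl = let x , rx = root-hasNeighbour in
                   any-≡true⁺ (∈-allFin x) (neighbour⇒child-of-root rx)
  ... | no _     = not-injective internal

  child : Fin (suc k) → Fin (suc k)
  child v = findOr {p = isParent G σ r v} v (allFin (suc k))

  child-isChild : ∀ v → isLeaf G σ r v ≡ false → isParent G σ r v (child v) ≡ true
  child-isChild v internal = findOr-satisfies v (allFin (suc k)) (internal⇒hasChild v internal)

  leafAtLayer : ℕ → Fin (suc k) → Bool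
  leafAtLayer i v = layer G r i v ∧ isLeaf G σ r v

  leafFrom : ℕ → Fin (suc k) → Bool
  leafFrom i v = isLeaf G σ r v ∧ distAtLeast i v

  count-layer≤leafAtLayer+layer-suc : ∀ i →
    count (layer G r i) ≤ count (leafAtLayer i) + count (layer G r (suc i))
  count-layer≤leafAtLayer+layer-suc i = begin
    count (layer G r i)                                ≡⟨ countIn-split (layer G r i) (isLeaf G σ r) (allFin _) ⟩
    count (leafAtLayer i) + count internalAtLayer      ≤⟨ +-monoʳ-≤ _ internal≤next ⟩
    count (leafAtLayer i) + count (layer G r (suc i))  ∎
    where
    open ≤-Reasoning

    internalAtLayer : Fin (suc k) → Bool
    internalAtLayer v = layer G r i v ∧ not (isLeaf G σ r v)

    child-of-internal : ∀ v → internalAtLayer v ≡ true → isParent G σ r v (child v) ≡ true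
    child-of-internal v l = child-isChild v (not-injective (∧-conicalʳ (layer G r i v) _ l))

    internal≤next : count internalAtLayer ≤ count (layer G r (suc i))
    internal≤next = injectiveOn⇒count≤ internalAtLayer (layer G r (suc i)) child
      (λ v l → parent-layer layered {i} {v} {child v} (child-of-internal v l)
                                                       (∧-conicalˡ (layer G r i v) _ l))
      (λ v v′ l l′ c≡c′ → parent-unique {v} {v′} {child v} (child-of-internal v l)
                             (subst (λ c → isParent G σ r v′ c ≡ true) (sym c≡c′)
                                    (child-of-internal v′ l′)))

  count-leafAtLayer+leafFrom-suc≤leafFrom : ∀ i →
    count (leafAtLayer i) + count (leafFrom (suc i)) ≤ count (leafFrom i)
  count-leafAtLayer+leafFrom-suc≤leafFrom i =
    countIn-disjoint (leafAtLayer i) (leafFrom (suc i)) (leafFrom i)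
    (λ v l → ∧-intro (∧-conicalʳ (layer G r i v) _ l) (layer⇒distAtLeast i (∧-conicalˡ _ _ l)))
    (λ v l → ∧-intro (∧-conicalˡ (isLeaf G σ r v) _ l)
                     (distAtLeast-suc i (∧-conicalʳ (isLeaf G σ r v) _ l)))
    (λ v l l′ → not-¬ (layer⇒ball {i} (∧-conicalˡ (layer G r i v) _ l))
                      (not-injective (∧-conicalʳ (isLeaf G σ r v) _ l′)))
    (allFin (suc k))

  count-layer≤leafFrom : ∀ d i → suc k ≤ d + i → count (layer G r i) ≤ count (leafFrom i)
  count-layer≤leafFrom zero i n≤i =
    countIn-mono (layer G r i) (leafFrom i) (λ v l → contradiction l (layer-empty layered i n≤i))
                 (allFin (suc k))
  count-layer≤leafFrom (suc d) i n≤1+d+i = begin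
    count (layer G r i)                                ≤⟨ count-layer≤leafAtLayer+layer-suc i ⟩
    count (leafAtLayer i) + count (layer G r (suc i))  ≤⟨ +-monoʳ-≤ _ (count-layer≤leafFrom d _ n≤d+1+i) ⟩
    count (leafAtLayer i) + count (leafFrom (suc i))   ≤⟨ count-leafAtLayer+leafFrom-suc≤leafFrom i ⟩
    count (leafFrom i)                                 ∎
    where
    open ≤-Reasoning
    n≤d+1+i : suc k ≤ d + suc i
    n≤d+1+i = subst (suc k ≤_) (sym (+-suc d i)) n≤1+d+i

  count-layer≤numLeaves : ∀ i → count (layer G r i) ≤ numLeaves G σ r
  count-layer≤numLeaves i =
    ≤-trans (count-layer≤leafFrom (suc k) i (m≤m+n (suc k) i))
            (countIn-mono (leafFrom i) (isLeaf G σ r) (λ v → ∧-conicalˡ (isLeaf G σ r v) _)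
                          (allFin (suc k)))

mainTheorem1 : (m : ℕ) (G : Graph (suc (suc m))) → Connected G →
    (σ : Permutation′ (suc (suc m))) → IsSearchOrdering G σ →
    IsLayered G σ (σ ⟨$⟩ʳ zero) →
    ∀ (i : ℕ) → count (layer G (σ ⟨$⟩ʳ zero) i) ≤ numLeaves G σ (σ ⟨$⟩ʳ zero)
mainTheorem1 m G connected σ _ layered =
  LeafBound.count-layer≤numLeaves G σ connected layered second≢first
  where
  second≢first : σ ⟨$⟩ʳ suc zero ≢ σ ⟨$⟩ʳ zero
  second≢first e with trans (sym (inverseˡ σ)) (trans (cong (σ ⟨$⟩ˡ_) e) (inverseˡ σ))
  ... | ()
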